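{- Let $G$ be a finite simple graph with vertex set $\{1,\dots,n\}$ and let $t\ge2$ be an integer. Let $x\in\Delta^{n-1}$ be a minimizer of $\Phi(G,\cdot)$ over $\Delta^{n-1}$. If $i,j\in\operatorname{Supp}(x)$ and $i$ is not adjacent to $j$, then both $y=x+x_j(e_i-e_j)$ and $y'=x+x_i(e_j-e_i)$ are also minimizers of $\Phi(G,\cdot)$ over $\Delta^{n-1}$.
   Context: $\Delta^{n-1}=\{x\in\mathbb{R}^n: x_i\ge0,\ \sum_i x_i=1\}$, $\operatorname{Supp}(x)=\{v: x_v\ne0\}$, $e_i$ is the $i$-th standard basis vector. $c(v)$ is the order of the largest clique of $G$ containing $v$, and \[ \Phi(G,x)=\sum_{v\in V(G)}\frac{x_v}{c(v)^t}\binom{c(v)}{t}-\sum_{K_t\subseteq G}\prod_{v\in V(K_t)}x_v, \] the second sum over all copies of $K_t$ in $G$. -}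

module Defs where

open import Level using (Level; _⊔_; suc)
open import Algebra.Bundles using (CommutativeRing)
open import Relation.Binary.Structures using (IsTotalOrder)
open import Relation.Nullary using (¬_)
open import Data.Bool using (Bool; true; false; if_then_else_; _∧_)
open import Data.Nat as ℕ using (ℕ; zero)
import Data.Nat.Combinatorics as Comb
open import Data.Fin using (Fin; _≟_)
open import Data.Vec using (Vec; []; _∷_; lookup)
open import Data.List using (List; []; _∷_; _++_; map; foldr; filter)
open import Data.List using (allFin) renaming (map to lmap)
open import Relation.Nullary.Decidable using (does)
open import Relation.Binary.PropositionalEquality using (_≡_)

-- Ordered fields (the reals ℝ are the intended instance; no reals in
-- agda-stdlib, so the statement is made for every ordered field).

record OrderedField (c ℓ₁ ℓ₂ : Level) : Set (Level.suc (c ⊔ ℓ₁ ⊔ ℓ₂)) where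
  field
    commutativeRing : CommutativeRing c ℓ₁
  open CommutativeRing commutativeRing public
  field
    _≤_          : Carrier → Carrier → Set ℓ₂
    isTotalOrder : IsTotalOrder _≈_ _≤_
    0≉1          : ¬ (0# ≈ 1#)
    +-mono-≤     : ∀ {a b} c → a ≤ b → (a + c) ≤ (b + c)
    *-nonneg     : ∀ {a b} → 0# ≤ a → 0# ≤ b → 0# ≤ (a * b)
    _⁻¹          : Carrier → Carrier
    ⁻¹-inverse   : ∀ a → ¬ (a ≈ 0#) → (a * (a ⁻¹)) ≈ 1#

record SimpleGraph (n : ℕ) : Set where
  field
    adj   : Fin n → Fin n → Bool
    sym   : ∀ i j → adj i j ≡ adj j i
    irrefl : ∀ i → adj i i ≡ false
open SimpleGraph public

Subset : ℕ → Set
Subset n = Vec Bool n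

allSubsets : ∀ n → List (Subset n)
allSubsets zero = [] ∷ []
allSubsets (ℕ.suc n) =
  map (false ∷_) (allSubsets n) ++ map (true ∷_) (allSubsets n)

size : ∀ {n} → Subset n → ℕ
size [] = 0
size (false ∷ s) = size s
size (true ∷ s) = ℕ.suc (size s)

andAll : ∀ {A : Set} → (A → Bool) → List A → Bool
andAll p = foldr (λ a b → p a ∧ b) true

isClique : ∀ {n} → SimpleGraph n → Subset n → Bool
isClique {n} G S =
  andAll (λ i → andAll (λ j →
      if lookup S i ∧ lookup S j
      then (if does (i ≟ j) then true else adj G i j)
      else true) (allFin n)) (allFin n)

maxList : List ℕ → ℕ
maxList = foldr ℕ._⊔_ 0

cliqueNumberAt : ∀ {n} → SimpleGraph n → Fin n → ℕ
cliqueNumberAt {n} G v =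
  maxList (lmap (λ S → if isClique G S ∧ lookup S v then size S else 0)
                (allSubsets n))

module _ {c ℓ₁ ℓ₂} (F : OrderedField c ℓ₁ ℓ₂) where
  open OrderedField F

  fromℕ : ℕ → Carrier
  fromℕ zero = 0#
  fromℕ (ℕ.suc k) = 1# + fromℕ k

  sumL : ∀ {A : Set} → (A → Carrier) → List A → Carrier
  sumL f = foldr (λ a r → f a + r) 0#

  prodL : ∀ {A : Set} → (A → Carrier) → List A → Carrier
  prodL f = foldr (λ a r → f a * r) 1#

  Σᵥ : ∀ {n} → (Fin n → Carrier) → Carrier
  Σᵥ {n} f = sumL f (allFin n)

  Φ : ∀ {n} → ℕ → SimpleGraph n → (Fin n → Carrier) → Carrier
  Φ {n} t G x =
    Σᵥ (λ v → x v * (fromℕ (cliqueNumberAt G v ℕ.^ t) ⁻¹)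
                  * fromℕ (cliqueNumberAt G v Comb.C t))
    - sumL (λ S → if isClique G S ∧ does (size S ℕ.≟ t)
                  then prodL (λ v → if lookup S v then x v else 1#) (allFin n)
                  else 0#)
           (allSubsets n)

  InSimplex : ∀ {n} → (Fin n → Carrier) → Set (ℓ₁ ⊔ ℓ₂)
  InSimplex x = (∀ i → 0# ≤ x i) Data.Product.× (Σᵥ x ≈ 1#)
    where import Data.Product

  IsMinimizer : ∀ {n} → ℕ → SimpleGraph n → (Fin n → Carrier) → Set (c ⊔ ℓ₁ ⊔ ℓ₂)
  IsMinimizer {n} t G x =
    InSimplex x Data.Product.×
    (∀ (z : Fin n → Carrier) → InSimplex z → Φ t G x ≤ Φ t G z)
    where import Data.Product

  e : ∀ {n} → Fin n → Fin n → Carrier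
  e i k = if does (i ≟ k) then 1# else 0#

{-# OPTIONS --safe #-}
-- Restricted to the line s ↦ x + s(e_i − e_j), Φ(G,·) is affine in s: the linear part is, and
-- since no clique contains both of the non-adjacent vertices i and j, each K_t-monomial has at
-- most one factor that moves with s. The endpoints s = x_j and s = −x_i of the segment inside the
-- simplex are y and y′, and they lie on either side of s = 0 because x_i, x_j ≠ 0. An affine
-- function that is minimal at an interior point of a segment is constant, so Φ(y) = Φ(y′) = Φ(x).
module Submission where

open import Defs
open import Data.Nat using (ℕ; _≥_)
import Data.Nat as ℕ
open import Data.Fin using (Fin; zero; suc; _≟_)
open import Data.Fin.Properties using (suc-injective)
open import Level using (_⊔_)
open import Data.Bool using (Bool; true; false; _∧_; if_then_else_)
open import Data.Product using (_×_; _,_; ∃-syntax)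
open import Data.List using (List; []; _∷_; tabulate; allFin)
open import Data.List.Membership.Propositional using (_∈_)
open import Data.List.Membership.Propositional.Properties using (∈-allFin)
open import Data.List.Relation.Unary.Any using (here; there)
open import Data.List.Relation.Unary.All using (All; []; _∷_)
open import Data.List.Relation.Unary.All.Properties using (tabulate⁺)
open import Data.Vec using (lookup)
open import Data.Maybe using (nothing)
open import Function using (_∘_; id; case_of_)
open import Relation.Nullary using (¬_; Dec; yes; no; does; contradiction)
open import Relation.Binary.Bundles using (Poset)
open import Relation.Binary.Structures using (IsTotalOrder)
open import Relation.Binary.PropositionalEquality
  using (_≡_; _≢_; refl; cong; ≢-sym) renaming (sym to ≡-sym; trans to ≡-trans)
open import Tactic.RingSolver.Core.AlmostCommutativeRing using (fromCommutativeRing)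
import Relation.Binary.Reasoning.PartialOrder as PartialOrderReasoning
import Relation.Binary.Reasoning.Setoid as SetoidReasoning

andAll-true : ∀ {A : Set} (p : A → Bool) (xs : List A) → andAll p xs ≡ true → ∀ {x} → x ∈ xs → p x ≡ true
andAll-true p (y ∷ ys) all-p x∈xs with p y in py
andAll-true p (y ∷ ys) ()    x∈xs         | false
andAll-true p (y ∷ ys) all-p (here refl)  | true = py
andAll-true p (y ∷ ys) all-p (there x∈ys) | true = andAll-true p ys all-p x∈ys

module _ {n} (G : SimpleGraph n) where

  private
    pair-in-clique : ∀ {a b e} {P : Set} (P? : Dec P) →
      (if a ∧ b then (if does P? then true else e) else true) ≡ true → a ≡ true → b ≡ true → e ≡ false → P
    pair-in-clique (yes p) _  refl refl _    = p
    pair-in-clique (no _)  () refl refl refl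

  clique-non-edge : ∀ S {i j} → isClique G S ≡ true → adj G i j ≡ false →
                    lookup S i ≡ true → lookup S j ≡ true → i ≡ j
  clique-non-edge S {i} {j} clq i≁j i∈S j∈S =
    pair-in-clique (i ≟ j) (andAll-true _ (allFin n) (andAll-true _ (allFin n) clq (∈-allFin i)) (∈-allFin j))
                   i∈S j∈S i≁j

  clique-meets-non-edge-once : ∀ S {i j} → isClique G S ≡ true → adj G i j ≡ false →
    ∃[ u ] ∀ v → v ≢ u → lookup S v ≡ true → v ≢ i × v ≢ j
  clique-meets-non-edge-once S {i} {j} clq i≁j with lookup S i in i∈S
  ... | false = j , λ v v≢j v∈S → (λ { refl → case ≡-trans (≡-sym i∈S) v∈S of λ () }) , v≢j
  ... | true  = i , λ v v≢i v∈S → v≢i , λ { refl → v≢i (≡-sym (clique-non-edge S clq i≁j i∈S v∈S)) }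

module _ {c ℓ₁ ℓ₂} (F : OrderedField c ℓ₁ ℓ₂) where

  open OrderedField F hiding (zero; sym; trans; refl)
  open OrderedField F using () renaming (sym to ≈-sym; trans to ≈-trans; refl to ≈-refl)
  open import Algebra.Properties.Ring ring using (-‿distribˡ-*; -‿distribʳ-*; -1*x≈-x)
  open import Algebra.Properties.Group +-group using (ε⁻¹≈ε)
  open import Algebra.Properties.CommutativeSemigroup *-commutativeSemigroup using (x∙yz≈y∙xz)
  open import Algebra.Properties.AbelianGroup +-abelianGroup using (xyx⁻¹≈y; ⁻¹-∙-comm; ⁻¹-anti-homo‿-)
  open import Algebra.Properties.Semiring.Sum semiring
    using (sum; ∑-distrib-+; *-distribˡ-sum; sum-replicate-zero; sum-cong-≋)
  open import Tactic.RingSolver.NonReflective (fromCommutativeRing commutativeRing (λ _ → nothing))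
    using (solve; _⊜_; _⊕_; _⊗_)

  ≤-poset : Poset c ℓ₁ ℓ₂
  ≤-poset = record { isPartialOrder = IsTotalOrder.isPartialOrder isTotalOrder }

  open Poset ≤-poset using (antisym) renaming (trans to ≤-trans; reflexive to ≤-reflexive)
  module ≤-Reasoning = PartialOrderReasoning ≤-poset
  module ≈-Reasoning = SetoidReasoning setoid

  y≈0⇒x+y≈x : ∀ a {b} → b ≈ 0# → a + b ≈ a
  y≈0⇒x+y≈x a b≈0 = ≈-trans (+-congˡ b≈0) (+-identityʳ a)

  x+y*[z-z]≈x : ∀ a b z → a + b * (z - z) ≈ a
  x+y*[z-z]≈x a b z = y≈0⇒x+y≈x a (≈-trans (*-congˡ (-‿inverseʳ z)) (zeroʳ b))

  x≉0∧xy≈0⇒y≈0 : ∀ {a b} → ¬ a ≈ 0# → a * b ≈ 0# → b ≈ 0#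
  x≉0∧xy≈0⇒y≈0 {a} {b} a≉0 ab≈0 = begin
    b                ≈⟨ *-identityˡ b ⟨
    1# * b           ≈⟨ *-congʳ (≈-trans (*-comm (a ⁻¹) a) (⁻¹-inverse a a≉0)) ⟨
    a ⁻¹ * a * b     ≈⟨ *-assoc (a ⁻¹) a b ⟩
    a ⁻¹ * (a * b)   ≈⟨ *-congˡ ab≈0 ⟩
    a ⁻¹ * 0#        ≈⟨ zeroʳ (a ⁻¹) ⟩
    0#               ∎
    where open ≈-Reasoning

  x≤x+y⇒0≤y : ∀ {a b} → a ≤ (a + b) → 0# ≤ b
  x≤x+y⇒0≤y {a} {b} a≤a+b = begin
    0#          ≈⟨ -‿inverseʳ a ⟨
    a - a       ≤⟨ +-mono-≤ (- a) a≤a+b ⟩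
    a + b - a   ≈⟨ xyx⁻¹≈y a b ⟩
    b           ∎
    where open ≤-Reasoning

  +-nonneg : ∀ {a b} → 0# ≤ a → 0# ≤ b → 0# ≤ (a + b)
  +-nonneg {a} {b} 0≤a 0≤b = begin
    0#       ≈⟨ +-identityʳ 0# ⟨
    0# + 0#  ≤⟨ +-mono-≤ 0# 0≤a ⟩
    a + 0#   ≈⟨ +-comm a 0# ⟩
    0# + a   ≤⟨ +-mono-≤ a 0≤b ⟩
    b + a    ≈⟨ +-comm b a ⟩
    a + b    ∎
    where open ≤-Reasoning

  0≤x∧0≤-x⇒x≈0 : ∀ {a} → 0# ≤ a → 0# ≤ (- a) → a ≈ 0#
  0≤x∧0≤-x⇒x≈0 {a} 0≤a 0≤-a = antisym a≤0 0≤a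
    where
    open ≤-Reasoning
    a≤0 : a ≤ 0#
    a≤0 = begin
      a         ≈⟨ +-identityˡ a ⟨
      0# + a    ≤⟨ +-mono-≤ a 0≤-a ⟩
      - a + a   ≈⟨ -‿inverseˡ a ⟩
      0#        ∎

  Constant : (Carrier → Carrier) → Set (c ⊔ ℓ₁)
  Constant f = ∀ s → f s ≈ f 0#

  Affine : (Carrier → Carrier) → Set (c ⊔ ℓ₁)
  Affine f = ∃[ slope ] ∀ s → f s ≈ f 0# + s * slope

  const-Affine : ∀ a → Affine (λ _ → a)
  const-Affine a = 0# , λ s → ≈-sym (y≈0⇒x+y≈x a (zeroʳ s))

  line-Affine : ∀ a d → Affine (λ s → a + s * d)
  line-Affine a d = d , λ s → +-congʳ (≈-sym (y≈0⇒x+y≈x a (zeroˡ d)))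

  line-Constant : ∀ a {d} → d ≈ 0# → Constant (λ s → a + s * d)
  line-Constant a {d} d≈0 s =
    ≈-trans (y≈0⇒x+y≈x a (≈-trans (*-congˡ d≈0) (zeroʳ s))) (≈-sym (y≈0⇒x+y≈x a (zeroˡ d)))

  Affine-+ : ∀ {f g} → Affine f → Affine g → Affine (λ s → f s + g s)
  Affine-+ {f} {g} (u , f≈) (v , g≈) = u + v , λ s → begin
    f s + g s                        ≈⟨ +-cong (f≈ s) (g≈ s) ⟩
    (f 0# + s * u) + (g 0# + s * v)  ≈⟨ solve 5 (λ a b s u v → ((a ⊕ s ⊗ u) ⊕ (b ⊕ s ⊗ v)) ⊜ ((a ⊕ b) ⊕ s ⊗ (u ⊕ v)))
                                              ≈-refl (f 0#) (g 0#) s u v ⟩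
    (f 0# + g 0#) + s * (u + v)      ∎
    where open ≈-Reasoning

  Affine-neg : ∀ {f} → Affine f → Affine (λ s → - f s)
  Affine-neg {f} (u , f≈) = - u , λ s → begin
    - f s              ≈⟨ -‿cong (f≈ s) ⟩
    - (f 0# + s * u)   ≈⟨ ⁻¹-∙-comm (f 0#) (s * u) ⟨
    - f 0# - s * u     ≈⟨ +-congˡ (-‿distribʳ-* s u) ⟩
    - f 0# + s * - u   ∎
    where open ≈-Reasoning

  Affine-- : ∀ {f g} → Affine f → Affine g → Affine (λ s → f s - g s)
  Affine-- f-affine g-affine = Affine-+ f-affine (Affine-neg g-affine)

  Constant-*-Affine : ∀ {f g} → Constant f → Affine g → Affine (λ s → f s * g s)
  Constant-*-Affine {f} {g} f-const (v , g≈) = f 0# * v , λ s → begin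
    f s * g s                    ≈⟨ *-cong (f-const s) (g≈ s) ⟩
    f 0# * (g 0# + s * v)        ≈⟨ solve 4 (λ a b s v → a ⊗ (b ⊕ s ⊗ v) ⊜ (a ⊗ b ⊕ s ⊗ (a ⊗ v)))
                                          ≈-refl (f 0#) (g 0#) s v ⟩
    f 0# * g 0# + s * (f 0# * v) ∎
    where open ≈-Reasoning

  Affine-*-Constant : ∀ {f g} → Affine f → Constant g → Affine (λ s → f s * g s)
  Affine-*-Constant {f} {g} (u , f≈) g-const = u * g 0# , λ s → begin
    f s * g s                    ≈⟨ *-cong (f≈ s) (g-const s) ⟩
    (f 0# + s * u) * g 0#        ≈⟨ solve 4 (λ a b s u → (a ⊕ s ⊗ u) ⊗ b ⊜ (a ⊗ b ⊕ s ⊗ (u ⊗ b)))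
                                          ≈-refl (f 0#) (g 0#) s u ⟩
    f 0# * g 0# + s * (u * g 0#) ∎
    where open ≈-Reasoning

  Affine-if : ∀ b {f} → Affine f → Affine (λ s → if b then f s else 0#)
  Affine-if true  f-affine = f-affine
  Affine-if false _        = const-Affine 0#

  Affine-sumL : ∀ {A : Set} {f : Carrier → A → Carrier} (xs : List A) →
                (∀ a → Affine (λ s → f s a)) → Affine (λ s → sumL F (f s) xs)
  Affine-sumL []       _        = const-Affine 0#
  Affine-sumL (a ∷ xs) f-affine = Affine-+ (f-affine a) (Affine-sumL xs f-affine)

  Constant-prodL : ∀ {A : Set} {f : Carrier → A → Carrier} {xs : List A} →
                   All (λ a → Constant (λ s → f s a)) xs → Constant (λ s → prodL F (f s) xs)
  Constant-prodL []                   s = ≈-refl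
  Constant-prodL (f-const ∷ fs-const) s = *-cong (f-const s) (Constant-prodL fs-const s)

  Affine-prodL-tabulate : ∀ {A : Set} {m} {f : Carrier → A → Carrier} (g : Fin m → A) (u : Fin m) →
                          (∀ v → v ≢ u → Constant (λ s → f s (g v))) → (∀ v → Affine (λ s → f s (g v))) →
                          Affine (λ s → prodL F (f s) (tabulate g))
  Affine-prodL-tabulate g zero    others-const f-affine =
    Affine-*-Constant (f-affine zero) (Constant-prodL (tabulate⁺ (λ v → others-const (suc v) λ ())))
  Affine-prodL-tabulate g (suc u) others-const f-affine =
    Constant-*-Affine (others-const zero λ ())
      (Affine-prodL-tabulate (g ∘ suc) u (λ v v≢u → others-const (suc v) (v≢u ∘ suc-injective))
                                         (f-affine ∘ suc))

  Affine-interior-minimum⇒Constant : ∀ {f a b} → Affine f → 0# ≤ a → 0# ≤ b → ¬ a ≈ 0# → ¬ b ≈ 0# →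
                                     f 0# ≤ f a → f 0# ≤ f (- b) → Constant f
  Affine-interior-minimum⇒Constant {f} {a} {b} (B , f≈) 0≤a 0≤b a≉0 b≉0 f0≤fa f0≤f-b s = begin
    f s           ≈⟨ f≈ s ⟩
    f 0# + s * B  ≈⟨ y≈0⇒x+y≈x (f 0#) (≈-trans (*-congˡ B≈0) (zeroʳ s)) ⟩
    f 0#          ∎
    where
    open ≈-Reasoning
    0≤aB : 0# ≤ (a * B)
    0≤aB = x≤x+y⇒0≤y (≤-trans f0≤fa (≤-reflexive (f≈ a)))
    0≤-bB : 0# ≤ (- b * B)
    0≤-bB = x≤x+y⇒0≤y (≤-trans f0≤f-b (≤-reflexive (f≈ (- b))))
    a[-bB]≈-[b[aB]] : a * (- b * B) ≈ - (b * (a * B))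
    a[-bB]≈-[b[aB]] = begin
      a * (- b * B)     ≈⟨ *-congˡ (-‿distribˡ-* b B) ⟨
      a * - (b * B)     ≈⟨ -‿distribʳ-* a (b * B) ⟨
      - (a * (b * B))   ≈⟨ -‿cong (x∙yz≈y∙xz a b B) ⟩
      - (b * (a * B))   ∎
    b[aB]≈0 : b * (a * B) ≈ 0#
    b[aB]≈0 = 0≤x∧0≤-x⇒x≈0 (*-nonneg 0≤b 0≤aB)
                            (≤-trans (*-nonneg 0≤a 0≤-bB) (≤-reflexive a[-bB]≈-[b[aB]]))
    B≈0 : B ≈ 0#
    B≈0 = x≉0∧xy≈0⇒y≈0 a≉0 (x≉0∧xy≈0⇒y≈0 b≉0 b[aB]≈0)

  sum-neg : ∀ {m} (f : Fin m → Carrier) → sum (λ k → - f k) ≈ - sum f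
  sum-neg f = begin
    sum (λ k → - f k)       ≈⟨ sum-cong-≋ (λ k → -1*x≈-x (f k)) ⟨
    sum (λ k → - 1# * f k)  ≈⟨ *-distribˡ-sum (- 1#) f ⟨
    - 1# * sum f            ≈⟨ -1*x≈-x (sum f) ⟩
    - sum f                 ∎
    where open ≈-Reasoning

  sum-e : ∀ {m} (i : Fin m) → sum (e F i) ≈ 1#
  sum-e {ℕ.suc m} zero    = y≈0⇒x+y≈x 1# (sum-replicate-zero m)
  sum-e {ℕ.suc m} (suc i) = ≈-trans (+-identityˡ _) (sum-e i)

  sumL-tabulate : ∀ {A : Set} {m} (f : A → Carrier) (g : Fin m → A) → sumL F f (tabulate g) ≡ sum (f ∘ g)
  sumL-tabulate {m = ℕ.zero}  f g = refl
  sumL-tabulate {m = ℕ.suc m} f g = cong (f (g zero) +_) (sumL-tabulate f (g ∘ suc))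

  e-≢ : ∀ {n} {i k : Fin n} → i ≢ k → e F i k ≈ 0#
  e-≢ {i = i} {k} i≢k with i ≟ k
  ... | yes i≡k = contradiction i≡k i≢k
  ... | no _    = ≈-refl

  transfer : ∀ {n} → (Fin n → Carrier) → Fin n → Fin n → Carrier → Fin n → Carrier
  transfer x i j s k = x k + s * (e F i k - e F j k)

  module _ {n} (x : Fin n → Carrier) where

    transfer-zero : ∀ i j k → transfer x i j 0# k ≈ x k
    transfer-zero i j k = y≈0⇒x+y≈x (x k) (zeroˡ _)

    transfer-swap : ∀ i j s k → transfer x j i s k ≈ transfer x i j (- s) k
    transfer-swap i j s k = +-congˡ (begin
      s * (e F j k - e F i k)      ≈⟨ *-congˡ (⁻¹-anti-homo‿- (e F i k) (e F j k)) ⟨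
      s * - (e F i k - e F j k)    ≈⟨ -‿distribʳ-* s _ ⟨
      - (s * (e F i k - e F j k))  ≈⟨ -‿distribˡ-* s _ ⟩
      - s * (e F i k - e F j k)    ∎)
      where open ≈-Reasoning

    transfer-Constant : ∀ {i j k} → i ≢ k → j ≢ k → Constant (λ s → transfer x i j s k)
    transfer-Constant {k = k} i≢k j≢k =
      line-Constant (x k) (≈-trans (+-cong (e-≢ i≢k) (-‿cong (e-≢ j≢k))) (-‿inverseʳ 0#))

    Σᵥ-transfer : ∀ i j s → Σᵥ F (transfer x i j s) ≈ Σᵥ F x
    Σᵥ-transfer i j s = begin
      Σᵥ F (transfer x i j s)                      ≡⟨ sumL-tabulate (transfer x i j s) id ⟩
      sum (transfer x i j s)                       ≈⟨ ∑-distrib-+ x (λ k → s * (e F i k - e F j k)) ⟩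
      sum x + sum (λ k → s * (e F i k - e F j k))  ≈⟨ +-congˡ (*-distribˡ-sum s (λ k → e F i k - e F j k)) ⟨
      sum x + s * sum (λ k → e F i k - e F j k)    ≈⟨ y≈0⇒x+y≈x (sum x) (≈-trans (*-congˡ Σδ≈0) (zeroʳ s)) ⟩
      sum x                                        ≡⟨ sumL-tabulate x id ⟨
      Σᵥ F x                                       ∎
      where
      open ≈-Reasoning
      Σδ≈0 : sum (λ k → e F i k - e F j k) ≈ 0#
      Σδ≈0 = begin
        sum (λ k → e F i k - e F j k)        ≈⟨ ∑-distrib-+ (e F i) (λ k → - e F j k) ⟩
        sum (e F i) + sum (λ k → - e F j k)  ≈⟨ +-cong (sum-e i) (≈-trans (sum-neg (e F j)) (-‿cong (sum-e j))) ⟩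
        1# - 1#                              ≈⟨ -‿inverseʳ 1# ⟩
        0#                                   ∎

    transfer-nonneg : (∀ k → 0# ≤ x k) → ∀ i j k → 0# ≤ transfer x i j (x j) k
    transfer-nonneg x≥0 i j k with i ≟ k | j ≟ k
    ... | yes _ | yes _    = begin
      0#                       ≤⟨ x≥0 k ⟩
      x k                      ≈⟨ x+y*[z-z]≈x (x k) (x j) 1# ⟨
      x k + x j * (1# - 1#)    ∎
      where open ≤-Reasoning
    ... | yes _ | no _     = begin
      0#                       ≤⟨ +-nonneg (x≥0 k) (x≥0 j) ⟩
      x k + x j                ≈⟨ +-congˡ (≈-trans (*-congˡ (y≈0⇒x+y≈x 1# ε⁻¹≈ε)) (*-identityʳ (x j))) ⟨
      x k + x j * (1# - 0#)    ∎
      where open ≤-Reasoning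
    ... | no _  | yes refl = begin
      0#                       ≈⟨ -‿inverseʳ (x j) ⟨
      x j - x j                ≈⟨ +-congˡ (-‿cong (*-identityʳ (x j))) ⟨
      x j - x j * 1#           ≈⟨ +-congˡ (-‿distribʳ-* (x j) 1#) ⟩
      x j + x j * - 1#         ≈⟨ +-congˡ (*-congˡ (+-identityˡ (- 1#))) ⟨
      x j + x j * (0# - 1#)    ∎
      where open ≤-Reasoning
    ... | no _  | no _     = begin
      0#                       ≤⟨ x≥0 k ⟩
      x k                      ≈⟨ x+y*[z-z]≈x (x k) (x j) 0# ⟨
      x k + x j * (0# - 0#)    ∎
      where open ≤-Reasoning

  sumL-cong : ∀ {A : Set} {f g : A → Carrier} (xs : List A) → (∀ a → f a ≈ g a) → sumL F f xs ≈ sumL F g xs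
  sumL-cong []       _   = ≈-refl
  sumL-cong (a ∷ xs) f≈g = +-cong (f≈g a) (sumL-cong xs f≈g)

  prodL-cong : ∀ {A : Set} {f g : A → Carrier} (xs : List A) → (∀ a → f a ≈ g a) → prodL F f xs ≈ prodL F g xs
  prodL-cong []       _   = ≈-refl
  prodL-cong (a ∷ xs) f≈g = *-cong (f≈g a) (prodL-cong xs f≈g)

  if-cong : ∀ b {p q r s} → p ≈ q → r ≈ s → (if b then p else r) ≈ (if b then q else s)
  if-cong true  p≈q _   = p≈q
  if-cong false _   r≈s = r≈s

  Φ-cong : ∀ {n} t (G : SimpleGraph n) {x z : Fin n → Carrier} → (∀ k → x k ≈ z k) → Φ F t G x ≈ Φ F t G z
  Φ-cong {n} t G x≈z =
    +-cong (sumL-cong (allFin n) (λ v → *-congʳ (*-congʳ (x≈z v))))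
           (-‿cong (sumL-cong (allSubsets n) (λ S →
             if-cong (isClique G S ∧ does (size S ℕ.≟ t))
                     (prodL-cong (allFin n) (λ v → if-cong (lookup S v) (x≈z v) ≈-refl)) ≈-refl)))

  Φ-transfer-Affine : ∀ {n} t (G : SimpleGraph n) x {i j} → adj G i j ≡ false →
                      Affine (λ s → Φ F t G (transfer x i j s))
  Φ-transfer-Affine {n} t G x {i} {j} i≁j =
    Affine-- (Affine-sumL (allFin n) (λ v →
               Affine-*-Constant (Affine-*-Constant (line-Affine (x v) _) (λ _ → ≈-refl)) (λ _ → ≈-refl)))
             (Affine-sumL (allSubsets n) clique-term-Affine)
    where
    factor : Subset n → Carrier → Fin n → Carrier
    factor S s v = if lookup S v then transfer x i j s v else 1#

    factor-Affine : ∀ S v → Affine (λ s → factor S s v)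
    factor-Affine S v with lookup S v
    ... | true  = line-Affine (x v) _
    ... | false = const-Affine 1#

    clique-product-Affine : ∀ S → isClique G S ≡ true → Affine (λ s → prodL F (factor S s) (allFin n))
    clique-product-Affine S clq with clique-meets-non-edge-once G S clq i≁j
    ... | u , others-off = Affine-prodL-tabulate id u factor-Constant (factor-Affine S)
      where
      factor-Constant : ∀ v → v ≢ u → Constant (λ s → factor S s v)
      factor-Constant v v≢u with lookup S v in v∈S
      ... | true  = let v≢i , v≢j = others-off v v≢u v∈S in transfer-Constant x (≢-sym v≢i) (≢-sym v≢j)
      ... | false = λ _ → ≈-refl

    clique-term-Affine : ∀ S → Affine (λ s → if isClique G S ∧ does (size S ℕ.≟ t)
                                             then prodL F (factor S s) (allFin n) else 0#)
    clique-term-Affine S with isClique G S in clq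
    ... | true  = Affine-if (does (size S ℕ.≟ t)) (clique-product-Affine S clq)
    ... | false = const-Affine 0#

  transfer-InSimplex : ∀ {n} {x : Fin n → Carrier} → InSimplex F x → ∀ i j → InSimplex F (transfer x i j (x j))
  transfer-InSimplex {x = x} (x≥0 , Σx≈1) i j =
    transfer-nonneg x x≥0 i j , ≈-trans (Σᵥ-transfer x i j (x j)) Σx≈1

  transfer-IsMinimizer : ∀ {n} t (G : SimpleGraph n) {x i j} → IsMinimizer F t G x →
                         ¬ x i ≈ 0# → ¬ x j ≈ 0# → adj G i j ≡ false → IsMinimizer F t G (transfer x i j (x j))
  transfer-IsMinimizer t G {x} {i} {j} (x∈Δ@(x≥0 , _) , x-min) xi≉0 xj≉0 i≁j =
    transfer-InSimplex x∈Δ i j ,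
    λ z z∈Δ → ≤-trans (≤-reflexive (≈-trans (f-constant (x j)) f0≈Φx)) (x-min z z∈Δ)
    where
    open ≤-Reasoning

    f : Carrier → Carrier
    f s = Φ F t G (transfer x i j s)

    f0≈Φx : f 0# ≈ Φ F t G x
    f0≈Φx = Φ-cong t G (transfer-zero x i j)

    f0≤f[xj] : f 0# ≤ f (x j)
    f0≤f[xj] = begin
      f 0#        ≈⟨ f0≈Φx ⟩
      Φ F t G x   ≤⟨ x-min _ (transfer-InSimplex x∈Δ i j) ⟩
      f (x j)     ∎

    f0≤f[-xi] : f 0# ≤ f (- x i)
    f0≤f[-xi] = begin
      f 0#                            ≈⟨ f0≈Φx ⟩
      Φ F t G x                       ≤⟨ x-min _ (transfer-InSimplex x∈Δ j i) ⟩
      Φ F t G (transfer x j i (x i))  ≈⟨ Φ-cong t G (transfer-swap x i j (x i)) ⟩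
      f (- x i)                       ∎

    f-constant : Constant f
    f-constant = Affine-interior-minimum⇒Constant (Φ-transfer-Affine t G x i≁j)
                   (x≥0 j) (x≥0 i) xj≉0 xi≉0 f0≤f[xj] f0≤f[-xi]

corollary1 : ∀ {c ℓ₁ ℓ₂} (F : OrderedField c ℓ₁ ℓ₂) (n : ℕ) (G : SimpleGraph n) (t : ℕ) → t ≥ 2 →
    (x : Fin n → OrderedField.Carrier F) → IsMinimizer F t G x →
    (i j : Fin n) → ¬ (OrderedField._≈_ F (x i) (OrderedField.0# F)) → ¬ (OrderedField._≈_ F (x j) (OrderedField.0# F)) →
    adj G i j ≡ false →
    IsMinimizer F t G (λ k → OrderedField._+_ F (x k) (OrderedField._*_ F (x j) (OrderedField._-_ F (e F i k) (e F j k))))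
    × IsMinimizer F t G (λ k → OrderedField._+_ F (x k) (OrderedField._*_ F (x i) (OrderedField._-_ F (e F j k) (e F i k))))
-- The argument works for every t.
corollary1 F n G t _ x x-min i j xi≉0 xj≉0 i≁j =
  transfer-IsMinimizer F t G x-min xi≉0 xj≉0 i≁j ,
  transfer-IsMinimizer F t G x-min xj≉0 xi≉0 (≡-trans (SimpleGraph.sym G j i) i≁j)
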